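{- Let $k_1,k_2,k_3\in\mathbb{Z}_{\geq 0}$. For every positive integer solution $(x,y,z)=(a,b,c)$ of \[x^2+y^2+z^2+k_1xy+k_2yz+k_3zx=(3+k_1+k_2+k_3)xyz,\] the numbers $a,b,c$ are pairwise relatively prime. -}

{-# OPTIONS --safe #-}
-- Vieta jumping: in a positive solution of Q(a,b,c) = m abc with a ≥ b ≥ c, the other root
-- a′ = m bc − k₁b − k₃c − a of the quadratic in a is again a positive solution, and a′ < a as soon
-- as m > 3 + k₁ + k₂ + k₃.  Infinite descent then rules out positive solutions at such levels m.
-- At the level m = 3 + k₁ + k₂ + k₃, a prime p dividing a and b divides c² and hence c, and
-- (a/p, b/p, c/p) would be a positive solution at the level p m.
module Submission where

open import Data.Nat using (ℕ; zero; suc; _+_; _*_; _≤_; _<_; _>_; NonZero; z<s; >-nonZero; >-nonZero⁻¹; nonTrivial⇒n>1)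
open import Data.Nat.Properties
open import Algebra.Properties.CommutativeSemigroup +-commutativeSemigroup using (xy∙z≈xz∙y; xy∙z≈yz∙x; xy∙z≈zx∙y)
open import Data.Nat.Coprimality using (Coprime)
open import Data.Nat.Divisibility
open import Data.Nat.Primality using (Prime; euclidsLemma; prime⇒nonTrivial; prime⇒nonZero)
open import Data.Nat.Primality.Factorisation using (factorise)
open import Data.Nat.Tactic.RingSolver using (solve-∀)
open import Data.List using ([]; _∷_)
open import Data.Nat.ListAction using (product)
open import Data.List.Relation.Unary.All using (_∷_)
open import Data.Product using (_×_; _,_; proj₁; proj₂; ∃-syntax)
open import Data.Sum using (_⊎_; inj₁; inj₂; reduce)
open import Data.Empty using (⊥; ⊥-elim)
open import Relation.Nullary using (¬_)
open import Function using (_$_)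
open import Relation.Binary.PropositionalEquality using (_≡_; refl; sym; trans; cong; subst; module ≡-Reasoning)

Q : (k₁ k₂ k₃ a b c : ℕ) → ℕ
Q k₁ k₂ k₃ a b c = a * a + b * b + c * c + k₁ * a * b + k₂ * b * c + k₃ * c * a

record IsSolution (m k₁ k₂ k₃ a b c : ℕ) : Set where
  constructor solves
  field
    equation : Q k₁ k₂ k₃ a b c ≡ m * a * b * c

open IsSolution

rotate-solution : ∀ {m k₁ k₂ k₃ a b c} → IsSolution m k₁ k₂ k₃ a b c → IsSolution m k₂ k₃ k₁ b c a
rotate-solution {m} {k₁} {k₂} {k₃} {a} {b} {c} (solves sol) = solves $
  trans (rotate-Q k₁ k₂ k₃ a b c) (trans sol (rotate-xyz m a b c))
  where
  rotate-Q : ∀ k₁ k₂ k₃ a b c → b * b + c * c + a * a + k₂ * b * c + k₃ * c * a + k₁ * a * b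
                            ≡ a * a + b * b + c * c + k₁ * a * b + k₂ * b * c + k₃ * c * a
  rotate-Q = solve-∀
  rotate-xyz : ∀ m a b c → m * a * b * c ≡ m * b * c * a
  rotate-xyz = solve-∀

reflect-solution : ∀ {m k₁ k₂ k₃ a b c} → IsSolution m k₁ k₂ k₃ a b c → IsSolution m k₃ k₂ k₁ a c b
reflect-solution {m} {k₁} {k₂} {k₃} {a} {b} {c} (solves sol) = solves $
  trans (reflect-Q k₁ k₂ k₃ a b c) (trans sol (reflect-xyz m a b c))
  where
  reflect-Q : ∀ k₁ k₂ k₃ a b c → a * a + c * c + b * b + k₃ * a * c + k₂ * c * b + k₁ * b * a
                             ≡ a * a + b * b + c * c + k₁ * a * b + k₂ * b * c + k₃ * c * a
  reflect-Q = solve-∀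
  reflect-xyz : ∀ m a b c → m * a * b * c ≡ m * a * c * b
  reflect-xyz = solve-∀

m*n>0⇒m>0 : ∀ m {n} → m * n > 0 → m > 0
m*n>0⇒m>0 m mn>0 = >-nonZero⁻¹ m {{m*n≢0⇒m≢0 m {{>-nonZero mn>0}}}}

m*n>0⇒n>0 : ∀ m {n} → m * n > 0 → n > 0
m*n>0⇒n>0 m {n} mn>0 = >-nonZero⁻¹ n {{m*n≢0⇒n≢0 m {{>-nonZero mn>0}}}}

m*n+m*o≤m*m+n*o : ∀ {m n o} → m ≤ n → m ≤ o → m * n + m * o ≤ m * m + n * o
m*n+m*o≤m*m+n*o {m} m≤n m≤o with m≤n⇒∃[o]m+o≡n m≤n | m≤n⇒∃[o]m+o≡n m≤o
... | u , refl | v , refl = ≤-trans (m≤m+n _ (u * v)) (≤-reflexive (expand m u v))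
  where
  expand : ∀ m u v → m * (m + u) + m * (m + v) + u * v ≡ m * m + (m + u) * (m + v)
  expand = solve-∀

vieta-jump : ∀ {m k₁ k₂ k₃ a b c} → 0 < b → IsSolution m k₁ k₂ k₃ a b c →
  ∃[ a′ ] 0 < a′ × a * a′ ≡ b * b + c * c + k₂ * b * c
        × a + (k₁ * b + k₃ * c) + a′ ≡ m * b * c × IsSolution m k₁ k₂ k₃ a′ b c
vieta-jump {m} {k₁} {k₂} {k₃} {a} {b} {c} b>0 sol = a′ , a′>0 , aa′≡e , roots-sum , partner-solution
  where
  open ≡-Reasoning
  X = k₁ * b + k₃ * c
  e = b * b + c * c + k₂ * b * c
  M = m * b * c

  Q-as-quadratic : ∀ x → Q k₁ k₂ k₃ x b c ≡ x * (x + X) + e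
  Q-as-quadratic x = expand k₁ k₂ k₃ x b c
    where
    expand : ∀ k₁ k₂ k₃ x b c → x * x + b * b + c * c + k₁ * x * b + k₂ * b * c + k₃ * c * x
                               ≡ x * (x + (k₁ * b + k₃ * c)) + (b * b + c * c + k₂ * b * c)
    expand = solve-∀

  rhs-as-multiple : ∀ x → m * x * b * c ≡ x * M
  rhs-as-multiple x = reassociate m x b c
    where
    reassociate : ∀ m x b c → m * x * b * c ≡ x * (m * b * c)
    reassociate = solve-∀

  quadratic-at-a : a * (a + X) + e ≡ a * M
  quadratic-at-a = trans (sym (Q-as-quadratic a)) (trans (equation sol) (rhs-as-multiple a))

  e>0 : e > 0
  e>0 = <-≤-trans (*-mono-< b>0 b>0) (≤-trans (m≤m+n (b * b) (c * c)) (m≤m+n _ (k₂ * b * c)))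

  a+X<M : a + X < M
  a+X<M = *-cancelˡ-< a (a + X) M (subst (a * (a + X) <_) quadratic-at-a (m<m+n _ e>0))

  a′ = proj₁ (m≤n⇒∃[o]m+o≡n (<⇒≤ a+X<M))
  roots-sum : a + X + a′ ≡ M
  roots-sum = proj₂ (m≤n⇒∃[o]m+o≡n (<⇒≤ a+X<M))

  aa′≡e : a * a′ ≡ e
  aa′≡e = +-cancelˡ-≡ (a * (a + X)) _ _ (begin
    a * (a + X) + a * a′ ≡⟨ sym (*-distribˡ-+ a (a + X) a′) ⟩
    a * (a + X + a′)     ≡⟨ cong (a *_) roots-sum ⟩
    a * M                ≡⟨ sym quadratic-at-a ⟩
    a * (a + X) + e      ∎)

  a′>0 : a′ > 0
  a′>0 = m*n>0⇒n>0 a (subst (_> 0) (sym aa′≡e) e>0)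

  partner-solution : IsSolution m k₁ k₂ k₃ a′ b c
  partner-solution = solves $ begin
    Q k₁ k₂ k₃ a′ b c        ≡⟨ Q-as-quadratic a′ ⟩
    a′ * (a′ + X) + e        ≡⟨ cong (a′ * (a′ + X) +_) (sym aa′≡e) ⟩
    a′ * (a′ + X) + a * a′   ≡⟨ collect a a′ X ⟩
    a′ * (a + X + a′)        ≡⟨ cong (a′ *_) roots-sum ⟩
    a′ * M                   ≡⟨ sym (rhs-as-multiple a′) ⟩
    m * a′ * b * c           ∎
    where
    collect : ∀ a a′ X → a′ * (a′ + X) + a * a′ ≡ a′ * (a + X + a′)
    collect = solve-∀

critical-bound : ∀ k₁ k₂ k₃ {b c} → 0 < c → c ≤ b →
  b * b + (b * b + c * c + k₂ * b * c) + b * (k₁ * b + k₃ * c) ≤ (3 + k₁ + k₂ + k₃) * (b * b * c)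
critical-bound k₁ k₂ k₃ {b} {c} c>0 c≤b = begin
  b * b + (b * b + c * c + k₂ * b * c) + b * (k₁ * b + k₃ * c)
    ≡⟨ regroup k₁ k₂ k₃ b c ⟩
  b * b + (b * b + c * c + k₂ * (b * c)) + (k₁ * (b * b) + k₃ * (b * c))
    ≤⟨ +-mono-≤ (+-mono-≤ bb≤B (+-mono-≤ (+-mono-≤ bb≤B cc≤B) (*-monoʳ-≤ k₂ bc≤B)))
                (+-mono-≤ (*-monoʳ-≤ k₁ bb≤B) (*-monoʳ-≤ k₃ bc≤B)) ⟩
  B + (B + B + k₂ * B) + (k₁ * B + k₃ * B)
    ≡⟨ collect k₁ k₂ k₃ B ⟩
  (3 + k₁ + k₂ + k₃) * B ∎
  where
  open ≤-Reasoning
  B = b * b * c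
  b≤bb : b ≤ b * b
  b≤bb = m≤m*n b b {{>-nonZero (<-≤-trans c>0 c≤b)}}
  bb≤B : b * b ≤ B
  bb≤B = m≤m*n (b * b) c {{>-nonZero c>0}}
  bc≤B : b * c ≤ B
  bc≤B = *-monoˡ-≤ c b≤bb
  cc≤B : c * c ≤ B
  cc≤B = *-monoˡ-≤ c (≤-trans c≤b b≤bb)
  regroup : ∀ k₁ k₂ k₃ b c → b * b + (b * b + c * c + k₂ * b * c) + b * (k₁ * b + k₃ * c)
                           ≡ b * b + (b * b + c * c + k₂ * (b * c)) + (k₁ * (b * b) + k₃ * (b * c))
  regroup = solve-∀
  collect : ∀ k₁ k₂ k₃ B → B + (B + B + k₂ * B) + (k₁ * B + k₃ * B) ≡ (3 + k₁ + k₂ + k₃) * B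
  collect = solve-∀

-- If a ≤ a′ then b(a + a′) ≤ b² + aa′ because (a − b)(a′ − b) ≥ 0, and the two Vieta relations
-- turn this into m b²c ≤ (3 + k₁ + k₂ + k₃) b²c.
vieta-partner-smaller : ∀ {m} k₁ k₂ k₃ {a a′ b c} → 3 + k₁ + k₂ + k₃ < m → 0 < c → c ≤ b → b ≤ a →
  a * a′ ≡ b * b + c * c + k₂ * b * c → a + (k₁ * b + k₃ * c) + a′ ≡ m * b * c → a′ < a
vieta-partner-smaller {m} k₁ k₂ k₃ {a} {a′} {b} {c} above c>0 c≤b b≤a aa′≡e roots-sum =
  ≰⇒> λ a≤a′ → <-irrefl refl (bM<bM a≤a′)
  where
  open ≤-Reasoning
  X = k₁ * b + k₃ * c
  B = b * b * c
  B>0 : B > 0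
  B>0 = *-mono-< (*-mono-< (<-≤-trans c>0 c≤b) (<-≤-trans c>0 c≤b)) c>0
  distribute : ∀ b a X a′ → b * (a + X + a′) ≡ b * a + b * a′ + b * X
  distribute = solve-∀
  reassociate : ∀ m b c → m * (b * b * c) ≡ b * (m * b * c)
  reassociate = solve-∀
  bM<bM : a ≤ a′ → b * (m * b * c) < b * (m * b * c)
  bM<bM a≤a′ = begin-strict
    b * (m * b * c)                               ≡⟨ cong (b *_) (sym roots-sum) ⟩
    b * (a + X + a′)                              ≡⟨ distribute b a X a′ ⟩
    b * a + b * a′ + b * X                        ≤⟨ +-monoˡ-≤ (b * X) (m*n+m*o≤m*m+n*o b≤a (≤-trans b≤a a≤a′)) ⟩
    b * b + a * a′ + b * X                        ≡⟨ cong (λ t → b * b + t + b * X) aa′≡e ⟩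
    b * b + (b * b + c * c + k₂ * b * c) + b * X  ≤⟨ critical-bound k₁ k₂ k₃ c>0 c≤b ⟩
    (3 + k₁ + k₂ + k₃) * B                        <⟨ *-monoˡ-< B {{>-nonZero B>0}} above ⟩
    m * B                                         ≡⟨ reassociate m b c ⟩
    b * (m * b * c)                               ∎

record SupercriticalSolution (m k₁ k₂ k₃ a b c : ℕ) : Set where
  field
    supercritical : 3 + k₁ + k₂ + k₃ < m
    a>0 : a > 0
    b>0 : b > 0
    c>0 : c > 0
    solution : IsSolution m k₁ k₂ k₃ a b c

open SupercriticalSolution

rotate-level : ∀ k₁ k₂ k₃ → 3 + k₁ + k₂ + k₃ ≡ 3 + k₂ + k₃ + k₁
rotate-level = solve-∀

reflect-level : ∀ k₁ k₂ k₃ → 3 + k₁ + k₂ + k₃ ≡ 3 + k₃ + k₂ + k₁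
reflect-level = solve-∀

rotate : ∀ {m k₁ k₂ k₃ a b c} → SupercriticalSolution m k₁ k₂ k₃ a b c → SupercriticalSolution m k₂ k₃ k₁ b c a
rotate {m} {k₁} {k₂} {k₃} s = record
  { supercritical = subst (_< m) (rotate-level k₁ k₂ k₃) (supercritical s)
  ; a>0 = b>0 s ; b>0 = c>0 s ; c>0 = a>0 s
  ; solution = rotate-solution (solution s)
  }

reflect : ∀ {m k₁ k₂ k₃ a b c} → SupercriticalSolution m k₁ k₂ k₃ a b c → SupercriticalSolution m k₃ k₂ k₁ a c b
reflect {m} {k₁} {k₂} {k₃} s = record
  { supercritical = subst (_< m) (reflect-level k₁ k₂ k₃) (supercritical s)
  ; a>0 = a>0 s ; b>0 = c>0 s ; c>0 = b>0 s
  ; solution = reflect-solution (solution s)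
  }

NoSupercriticalSolutionBelow : ℕ → Set
NoSupercriticalSolutionBelow n =
  ∀ {m k₁ k₂ k₃ a b c} → a + b + c < n → ¬ SupercriticalSolution m k₁ k₂ k₃ a b c

descend-sorted : ∀ {n m k₁ k₂ k₃ a b c} → NoSupercriticalSolutionBelow n → c ≤ b → b ≤ a →
  a + b + c ≤ n → ¬ SupercriticalSolution m k₁ k₂ k₃ a b c
descend-sorted {k₁ = k₁} {k₂} {k₃} {a} {b} {c} ih c≤b b≤a size s with vieta-jump (b>0 s) (solution s)
... | a′ , a′>0 , aa′≡e , roots-sum , partner-solution =
  ih (<-≤-trans (+-monoˡ-< c (+-monoˡ-< b a′<a)) size)
     (record { supercritical = supercritical s ; a>0 = a′>0 ; b>0 = b>0 s ; c>0 = c>0 s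
             ; solution = partner-solution })
  where
  a′<a : a′ < a
  a′<a = vieta-partner-smaller k₁ k₂ k₃ (supercritical s) (c>0 s) c≤b b≤a aa′≡e roots-sum

descend-from-max : ∀ {n m k₁ k₂ k₃ a b c} → NoSupercriticalSolutionBelow n → b ≤ a → c ≤ a →
  a + b + c ≤ n → ¬ SupercriticalSolution m k₁ k₂ k₃ a b c
descend-from-max {n} {a = a} {b} {c} ih b≤a c≤a size s with ≤-total c b
... | inj₁ c≤b = descend-sorted ih c≤b b≤a size s
... | inj₂ b≤c = descend-sorted ih b≤c c≤a (subst (_≤ n) (xy∙z≈xz∙y a b c) size) (reflect s)

maximum-of-three : ∀ a b c → (b ≤ a × c ≤ a) ⊎ (c ≤ b × a ≤ b) ⊎ (a ≤ c × b ≤ c)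
maximum-of-three a b c with ≤-total b a | ≤-total c a | ≤-total c b
... | inj₁ b≤a | inj₁ c≤a | _        = inj₁ (b≤a , c≤a)
... | inj₁ b≤a | inj₂ a≤c | _        = inj₂ (inj₂ (a≤c , ≤-trans b≤a a≤c))
... | inj₂ a≤b | _        | inj₁ c≤b = inj₂ (inj₁ (c≤b , a≤b))
... | inj₂ a≤b | _        | inj₂ b≤c = inj₂ (inj₂ (≤-trans a≤b b≤c , b≤c))

no-supercritical-solution-below : ∀ n → NoSupercriticalSolutionBelow n
no-supercritical-solution-below zero ()
no-supercritical-solution-below (suc n) {a = a} {b} {c} size s with maximum-of-three a b c
... | inj₁ (b≤a , c≤a) =
  descend-from-max (no-supercritical-solution-below n) b≤a c≤a (≤-pred size) s
... | inj₂ (inj₁ (c≤b , a≤b)) =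
  descend-from-max (no-supercritical-solution-below n) c≤b a≤b
    (subst (_≤ n) (xy∙z≈yz∙x a b c) (≤-pred size)) (rotate s)
... | inj₂ (inj₂ (a≤c , b≤c)) =
  descend-from-max (no-supercritical-solution-below n) a≤c b≤c
    (subst (_≤ n) (xy∙z≈zx∙y a b c) (≤-pred size)) (rotate (rotate s))

no-supercritical-solution : ∀ {m k₁ k₂ k₃ a b c} → ¬ SupercriticalSolution m k₁ k₂ k₃ a b c
no-supercritical-solution = no-supercritical-solution-below _ ≤-refl

∄common-prime⇒coprime : ∀ {m n} → m > 0 → (∀ {p} → Prime p → p ∣ m → p ∣ n → ⊥) → Coprime m n
∄common-prime⇒coprime m>0 _ {zero} (0∣m , _) = ⊥-elim (n>0⇒n≢0 m>0 (0∣⇒≡0 0∣m))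
∄common-prime⇒coprime m>0 ∄common-prime {suc d} (d∣m , d∣n) with factorise (suc d)
... | record { factors = [] ; isFactorisation = d≡1 } = d≡1
... | record { factors = p ∷ ps ; isFactorisation = d≡p*ps ; factorsPrime = p-prime ∷ _ } =
  ⊥-elim (∄common-prime p-prime (∣-trans p∣d d∣m) (∣-trans p∣d d∣n))
  where
  p∣d : p ∣ suc d
  p∣d = subst (p ∣_) (sym d≡p*ps) (m∣m*n (product ps))

prime∣a∧prime∣b⇒prime∣c : ∀ {m k₁ k₂ k₃ a b c p} → Prime p → IsSolution m k₁ k₂ k₃ a b c →
  p ∣ a → p ∣ b → p ∣ c
prime∣a∧prime∣b⇒prime∣c {m} {k₁} {k₂} {k₃} {a} {b} {c} {p} p-prime sol p∣a p∣b =
  reduce (euclidsLemma c c p-prime p∣c*c)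
  where
  split : ∀ k₁ k₂ k₃ a b c → a * a + b * b + c * c + k₁ * a * b + k₂ * b * c + k₃ * c * a
                          ≡ a * (a + k₁ * b + k₃ * c) + b * (b + k₂ * c) + c * c
  split = solve-∀
  p∣Q : p ∣ a * (a + k₁ * b + k₃ * c) + b * (b + k₂ * c) + c * c
  p∣Q = subst (p ∣_) (trans (sym (equation sol)) (split k₁ k₂ k₃ a b c))
          (∣m⇒∣m*n c (∣m⇒∣m*n b (∣n⇒∣m*n m p∣a)))
  p∣c*c : p ∣ c * c
  p∣c*c = ∣m+n∣m⇒∣n p∣Q (∣m∣n⇒∣m+n (∣m⇒∣m*n _ p∣a) (∣m⇒∣m*n _ p∣b))

scale-down : ∀ {m k₁ k₂ k₃ a b c} p .{{_ : NonZero p}} →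
  IsSolution m k₁ k₂ k₃ (a * p) (b * p) (c * p) → IsSolution (m * p) k₁ k₂ k₃ a b c
scale-down {m} {k₁} {k₂} {k₃} {a} {b} {c} p (solves eq) = solves $
  *-cancelˡ-≡ _ _ (p * p) {{m*n≢0 p p}}
    (trans (expand-Q k₁ k₂ k₃ a b c p) (trans eq (expand-rhs m a b c p)))
  where
  expand-Q : ∀ k₁ k₂ k₃ a b c p →
    p * p * (a * a + b * b + c * c + k₁ * a * b + k₂ * b * c + k₃ * c * a)
    ≡ a * p * (a * p) + b * p * (b * p) + c * p * (c * p)
      + k₁ * (a * p) * (b * p) + k₂ * (b * p) * (c * p) + k₃ * (c * p) * (a * p)
  expand-Q = solve-∀
  expand-rhs : ∀ m a b c p → m * (a * p) * (b * p) * (c * p) ≡ p * p * (m * p * a * b * c)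
  expand-rhs = solve-∀

solution-coprime : ∀ {m k₁ k₂ k₃ a b c} → 3 + k₁ + k₂ + k₃ ≤ m → a > 0 → b > 0 → c > 0 →
  IsSolution m k₁ k₂ k₃ a b c → Coprime a b
solution-coprime {m} {a = a} {b} critical a>0 b>0 c>0 sol = ∄common-prime⇒coprime a>0 ∄common-prime
  where
  ∄common-prime : ∀ {p} → Prime p → p ∣ a → p ∣ b → ⊥
  ∄common-prime {p} p-prime p∣a p∣b
    with p∣a | p∣b | prime∣a∧prime∣b⇒prime∣c p-prime sol p∣a p∣b
  ... | divides-refl A | divides-refl B | divides-refl C = no-supercritical-solution (record
    { supercritical = ≤-<-trans critical (m<m*n m p {{>-nonZero m>0}} (nonTrivial⇒n>1 p {{prime⇒nonTrivial p-prime}}))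
    ; a>0 = m*n>0⇒m>0 A a>0 ; b>0 = m*n>0⇒m>0 B b>0 ; c>0 = m*n>0⇒m>0 C c>0
    ; solution = scale-down p {{prime⇒nonZero p-prime}} sol
    })
    where
    m>0 : m > 0
    m>0 = <-≤-trans z<s critical

corollary2p6 : (k₁ k₂ k₃ a b c : ℕ) → a > 0 → b > 0 → c > 0 →
    a * a + b * b + c * c + k₁ * a * b + k₂ * b * c + k₃ * c * a
      ≡ (3 + k₁ + k₂ + k₃) * a * b * c →
    Coprime a b × Coprime b c × Coprime c a
corollary2p6 k₁ k₂ k₃ a b c a>0 b>0 c>0 eq =
    solution-coprime ≤-refl a>0 b>0 c>0 sol
  , solution-coprime (≤-reflexive (sym (rotate-level k₁ k₂ k₃))) b>0 c>0 a>0 (rotate-solution sol)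
  , solution-coprime (≤-reflexive (rotate-level k₃ k₁ k₂)) c>0 a>0 b>0 (rotate-solution (rotate-solution sol))
  where
  sol : IsSolution (3 + k₁ + k₂ + k₃) k₁ k₂ k₃ a b c
  sol = solves eq
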